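{- $\mathbf{MNP}\subseteq\oplus\mathbf{P}$.
   Context: For a polynomial $p$, a polynomial-time computable predicate $R$ and input $x$, write $N(x)=|\{y : |y|=p(|x|)\wedge R(x,y)\}|$. A language $L$ is in $\mathbf{MNP}$ if there exist $p,R$ such that for all $x$: if $x\in L$ then $N(x)=2^t-1$ for some $t\in\{1,2,3,\dots\}$, and if $x\notin L$ then $N(x)=0$. A language $L$ is in $\oplus\mathbf{P}$ if there exist $p,R$ such that for all $x$: $x\in L\iff N(x)$ is odd. -}

module Defs where

open import Data.Bool using (Bool; true; false; if_then_else_)
open import Data.Nat using (ℕ; zero; suc; _+_; _*_; _^_; _∸_; _≤_)
open import Data.Fin using (Fin)
open import Data.List using (List; []; _∷_; length; map; _++_; filterᵇ)
open import Data.Product using (Σ; ∃; _×_; _,_)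
open import Relation.Binary.PropositionalEquality using (_≡_)
open import Relation.Nullary using (¬_)

Word : Set
Word = List Bool

Language : Set
Language = Word → Bool

allWords : ℕ → List Word
allWords zero    = [] ∷ []
allWords (suc m) = map (false ∷_) (allWords m) ++ map (true ∷_) (allWords m)

-- Polynomials with natural-number coefficients (c₀ ∷ c₁ ∷ … = c₀ + c₁ n + …)

Poly : Set
Poly = List ℕ

eval : Poly → ℕ → ℕ
eval []       n = 0
eval (c ∷ cs) n = c + n * eval cs n

-- Deterministic single-tape Turing machines over the tape alphabet
-- {blank, 0, 1, #}; '#' separates the two arguments of a predicate.

data Sym : Set where
  blank b0 b1 sep : Sym

data Move : Set where
  mvL mvR mvS : Move

record TM : Set where
  field
    nStates : ℕ
    start   : Fin nStates
    halted  : Fin nStates → Bool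
    accepts : Fin nStates → Bool   -- accepting (meaningful on halting states)
    δ       : Fin nStates → Sym → Fin nStates × Sym × Move

-- configuration: state, tape left of head (nearest first), scanned symbol, tape right of head
record Config (M : TM) : Set where
  constructor conf
  field
    state : Fin (TM.nStates M)
    left  : List Sym
    here  : Sym
    right : List Sym

private
  headOr : List Sym → Sym × List Sym
  headOr []       = blank , []
  headOr (s ∷ ss) = s , ss

move : (M : TM) → Fin (TM.nStates M) → List Sym → Sym → List Sym → Move → Config M
move M q l a r mvL with headOr l
... | (b , l') = conf q l' b (a ∷ r)
move M q l a r mvR with headOr r
... | (b , r') = conf q (a ∷ l) b r'
move M q l a r mvS = conf q l a r

step : (M : TM) → Config M → Config M
step M (conf q l a r) with TM.halted M q
... | true  = conf q l a r
... | false with TM.δ M q a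
...   | (q' , a' , d) = move M q' l a' r d

run : (M : TM) → ℕ → Config M → Config M
run M zero    c = c
run M (suc k) c = run M k (step M c)

encBit : Bool → Sym
encBit false = b0
encBit true  = b1

initConfig : (M : TM) → List Sym → Config M
initConfig M []       = conf (TM.start M) [] blank []
initConfig M (s ∷ ss) = conf (TM.start M) [] s ss

encodePair : Word → Word → List Sym
encodePair x y = map encBit x ++ (sep ∷ map encBit y)

HaltsWithin : (M : TM) → ℕ → List Sym → Bool → Set
HaltsWithin M t w b =
  let c = run M t (initConfig M w) in
  (TM.halted M (Config.state c) ≡ true) × (TM.accepts M (Config.state c) ≡ b)

PolyTimePredicate : (Word → Word → Bool) → Set
PolyTimePredicate R =
  Σ TM λ M → Σ Poly λ q →
    ∀ x y → HaltsWithin M (eval q (length x + length y)) (encodePair x y) (R x y)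

count : Poly → (Word → Word → Bool) → Word → ℕ
count p R x = length (filterᵇ (R x) (allWords (eval p (length x))))

Odd : ℕ → Set
Odd n = ∃ λ k → n ≡ suc (2 * k)

MNP : Language → Set
MNP Lang = Σ Poly λ p → Σ (Word → Word → Bool) λ R →
  PolyTimePredicate R ×
  (∀ x → (Lang x ≡ true  → ∃ λ t → (1 ≤ t) × (count p R x ≡ 2 ^ t ∸ 1))
       × (Lang x ≡ false → count p R x ≡ 0))

ParityP : Language → Set
ParityP Lang = Σ Poly λ p → Σ (Word → Word → Bool) λ R →
  PolyTimePredicate R ×
  (∀ x → (Lang x ≡ true → Odd (count p R x)) × (Odd (count p R x) → Lang x ≡ true))

-- Every count of the form 2^t − 1 with t ≥ 1 is odd and 0 is even, so the very
-- same polynomial and predicate that witness MNP already witness ⊕P.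
module Submission where

open import Defs
open import Data.Bool using (true; false)
open import Data.Nat using (suc; _+_; _*_; _^_; _∸_; _≤_; NonZero)
open import Data.Nat.Properties using (+-suc; m^n≢0)
open import Data.Product using (_,_; proj₁; proj₂)
open import Relation.Binary.PropositionalEquality using (_≡_; refl; sym; subst)
open import Relation.Nullary using (¬_; contradiction)

2*n∸1≡1+2*[n∸1] : ∀ n .{{_ : NonZero n}} → 2 * n ∸ 1 ≡ suc (2 * (n ∸ 1))
2*n∸1≡1+2*[n∸1] (suc m) = +-suc m (m + 0)

odd-2^t∸1 : ∀ {t} → 1 ≤ t → Odd (2 ^ t ∸ 1)
odd-2^t∸1 {suc t} _ = 2 ^ t ∸ 1 , 2*n∸1≡1+2*[n∸1] (2 ^ t) {{m^n≢0 2 t}}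

¬odd-0 : ¬ Odd 0
¬odd-0 (_ , ())

theorem6 : (Lang : Language) → MNP Lang → ParityP Lang
theorem6 Lang (p , R , R-polytime , N-spec) =
  p , R , R-polytime , λ x → member⇒odd x , odd⇒member x
  where
  member⇒odd : ∀ x → Lang x ≡ true → Odd (count p R x)
  member⇒odd x x∈L with proj₁ (N-spec x) x∈L
  ... | _ , 1≤t , N≡2^t∸1 = subst Odd (sym N≡2^t∸1) (odd-2^t∸1 1≤t)

  odd⇒member : ∀ x → Odd (count p R x) → Lang x ≡ true
  odd⇒member x odd-N with Lang x in Lang-x≡b
  ... | true  = refl
  ... | false = contradiction (subst Odd (proj₂ (N-spec x) Lang-x≡b) odd-N) ¬odd-0
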